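{- Let $\kappa_{\rm TM}$ be the two-block substitution on $\{0,1\}$ given by $\kappa_{\rm TM}(00)=001$, $\kappa_{\rm TM}(01)=010$, $\kappa_{\rm TM}(10)=101$, $\kappa_{\rm TM}(11)=110$, and let $x=x^{(00)}=x_0x_1x_2\dots$ be the infinite fixed point of $\kappa_{\rm TM}$ with prefix $00$. Then $x$ is not eventually periodic.
   Context: A two-block substitution $\kappa:\{00,01,10,11\}\rightarrow\{0,1\}^*$ acts on an infinite word $x=x_0x_1x_2\dots$ by $\kappa(x)=\kappa(x_0x_1)\kappa(x_2x_3)\kappa(x_4x_5)\cdots$. The fixed point $x^{(00)}$ is the unique infinite 0-1 word beginning with $00$ satisfying $\kappa_{\rm TM}(x)=x$; equivalently $x_0=x_1=0$ and $x_{3n}=x_{2n}$, $x_{3n+1}=x_{2n+1}$, $x_{3n+2}=1-x_{2n+1}$ for all $n\ge0$. It begins $001110101101110010110001101110001\dots$. An infinite word is eventually periodic if it is of the form $pwww\dots$ for finite words $p$ and nonempty $w$. -}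

module Defs where

open import Data.Bool using (Bool; true; false)
open import Data.Nat using (ℕ; zero; suc; _+_; _*_; _≤_; NonZero)
open import Data.Nat.DivMod using (_/_; _%_)
open import Data.Product using (Σ; _×_; ∃)
open import Relation.Binary.PropositionalEquality using (_≡_)
open import Relation.Nullary using (¬_)

-- Infinite 0-1 words: false = 0, true = 1.
Word : Set
Word = ℕ → Bool

-- κ_TM on a two-block, written as its three output letters (all images have length 3):
-- κ(00)=001, κ(01)=010, κ(10)=101, κ(11)=110.
κTM-block : Bool → Bool → ℕ → Bool
κTM-block false false 0 = false
κTM-block false false 1 = false
κTM-block false false _ = true
κTM-block false true  0 = false
κTM-block false true  1 = true
κTM-block false true  _ = false
κTM-block true  false 0 = true
κTM-block true  false 1 = false
κTM-block true  false _ = true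
κTM-block true  true  0 = true
κTM-block true  true  1 = true
κTM-block true  true  _ = false

-- Action on an infinite word: κ(x) = κ(x0x1) κ(x2x3) ...; since every block image
-- has length 3, letter m of κ(x) is letter (m mod 3) of κ(x_{2q} x_{2q+1}), q = m div 3.
κTM : Word → Word
κTM x m = κTM-block (x (2 * (m / 3))) (x (2 * (m / 3) + 1)) (m % 3)

IsFixedPoint00 : Word → Set
IsFixedPoint00 x = (x 0 ≡ false) × (x 1 ≡ false) × (∀ m → κTM x m ≡ x m)

EventuallyPeriodic : Word → Set
EventuallyPeriodic x =
  Σ ℕ λ N → Σ ℕ λ k → (1 ≤ k) × (∀ n → N ≤ n → x (n + k) ≡ x n)

-- Call k a twisted period of a word x if eventually x(n+k) = x(n) xor c for a fixed bit c.
-- Writing eₙ = x(2n) and oₙ = x(2n+1), a fixed point of κ_TM satisfies x(3n) = eₙ,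
-- x(3n+1) = oₙ and x(3n+2) = not oₙ.  Reading a twisted period k = 3q + r of x at the
-- positions 3n, 3n+1, 3n+2 yields a common twisted period of e and o, hence of x, namely
-- 2q, 2q or 2q+2 according to r; it is smaller than k once k ≥ 3.  By descent x would
-- have twisted period 1 or 2.  A twisted period 1 doubles to the period 2, and the step
-- for k = 2 flips the bit of a twisted period 2, which is absurd.
module Submission where

open import Defs
open import Relation.Nullary using (¬_)
open import Data.Bool using (Bool; true; false; not; _xor_)
open import Data.Bool.Properties
  using (not-involutive; not-injective; not-¬; not-distribˡ-xor; not-distribʳ-xor;
         xor-assoc; xor-same; xor-identityʳ)
open import Data.Nat using (ℕ; zero; suc; _+_; _*_; _≤_; _<_; _⊔_; z≤n; s≤s; s≤s⁻¹)
open import Data.Nat.Properties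
  using (≤-refl; ≤-trans; ≤-reflexive; m≤m+n; m≤n*m; m≤m⊔n; m≤n⊔m; n<1+n; m≤n⇒∃[o]m+o≡n;
         +-comm; +-assoc; +-suc; +-identityʳ; *-distribˡ-+; +-monoˡ-<; *-monoˡ-<; *-cancelˡ-<; *-cancelˡ-≤)
open import Data.Nat.DivMod using (_/_; _%_; [m+kn]%n≡m%n; m<n⇒m%n≡m; +-distrib-/-∣ʳ;
                                   m<n⇒m/n≡0; m*n/n≡m)
open import Data.Nat.Divisibility using (divides-refl)
open import Data.Nat.Induction using (<-rec)
open import Data.Nat.Tactic.RingSolver using (solve-∀; solve)
open import Data.List using (_∷_; [])
open import Data.Empty using (⊥)
open import Data.Product using (Σ; _×_; _,_; proj₁; proj₂)
open import Relation.Binary.PropositionalEquality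
open ≡-Reasoning

Eventually : (ℕ → Set) → Set
Eventually P = Σ ℕ λ N → ∀ n → N ≤ n → P n

eventually-× : ∀ {P Q : ℕ → Set} → Eventually P → Eventually Q → Eventually (λ n → P n × Q n)
eventually-× (M , p) (N , q) = M ⊔ N , λ n M⊔N≤n →
  p n (≤-trans (m≤m⊔n M N) M⊔N≤n) , q n (≤-trans (m≤n⊔m M N) M⊔N≤n)

eventually-shift : ∀ {P : ℕ → Set} g → Eventually (λ n → P (n + g)) → Eventually P
eventually-shift {P} g (N , p) = N + g , λ n N+g≤n → shifted n (m≤n⇒∃[o]m+o≡n N+g≤n)
  where
    shifted : ∀ n → Σ ℕ (λ o → N + g + o ≡ n) → P n
    shifted n (o , refl) = subst P (+-comm-middle N o g) (p (N + o) (m≤m+n N o))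
      where
        +-comm-middle : ∀ a b c → a + b + c ≡ a + c + b
        +-comm-middle = solve-∀

TwistedPeriod : Word → ℕ → Bool → Set
TwistedPeriod x k c = Eventually λ n → x (n + k) ≡ x n xor c

xor-cancelˡ : ∀ a {b c} → a xor b ≡ a xor c → b ≡ c
xor-cancelˡ false eq = eq
xor-cancelˡ true  eq = not-injective eq

xor-swap : ∀ {a b} c → b ≡ a xor c → a ≡ b xor c
xor-swap {a} c refl = begin
  a                  ≡⟨ xor-identityʳ a ⟨
  a xor false        ≡⟨ cong (a xor_) (xor-same c) ⟨
  a xor (c xor c)    ≡⟨ xor-assoc a c c ⟨
  (a xor c) xor c    ∎

not-xor : ∀ a c → not a xor c ≡ a xor not c
not-xor a c = trans (sym (not-distribˡ-xor a c)) (not-distribʳ-xor a c)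

xor-xor-not : ∀ a c → (a xor c) xor not c ≡ not a
xor-xor-not false false = refl
xor-xor-not false true  = refl
xor-xor-not true  false = refl
xor-xor-not true  true  = refl

data EvenOrOdd : ℕ → Set where
  even : ∀ i → EvenOrOdd (2 * i)
  odd  : ∀ i → EvenOrOdd (2 * i + 1)

evenOrOdd : ∀ n → EvenOrOdd n
evenOrOdd zero = even 0
evenOrOdd (suc n) with evenOrOdd n
... | even i = subst EvenOrOdd (+-comm (2 * i) 1) (odd i)
... | odd i  = subst EvenOrOdd (2[1+i]≡2i+1+1 i) (even (suc i))
  where
    2[1+i]≡2i+1+1 : ∀ i → 2 * suc i ≡ suc (2 * i + 1)
    2[1+i]≡2i+1+1 = solve-∀

data Mod3 : ℕ → Set where
  3q   : ∀ q → Mod3 (3 * q)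
  3q+1 : ∀ q → Mod3 (3 * q + 1)
  3q+2 : ∀ q → Mod3 (3 * q + 2)

mod3 : ∀ n → Mod3 n
mod3 zero = 3q 0
mod3 (suc n) with mod3 n
... | 3q q   = subst Mod3 (+-comm (3 * q) 1) (3q+1 q)
... | 3q+1 q = subst Mod3 (+-suc (3 * q) 1) (3q+2 q)
... | 3q+2 q = subst Mod3 (3[1+q]≡3q+2+1 q) (3q (suc q))
  where
    3[1+q]≡3q+2+1 : ∀ q → 3 * suc q ≡ suc (3 * q + 2)
    3[1+q]≡3q+2+1 = solve-∀

m≤n⇒m≤3*n : ∀ {m n} → m ≤ n → m ≤ 3 * n
m≤n⇒m≤3*n {n = n} m≤n = ≤-trans m≤n (m≤n*m n 3)

m≤n⇒m≤3*n+o : ∀ {m n} o → m ≤ n → m ≤ 3 * n + o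
m≤n⇒m≤3*n+o {n = n} o m≤n = ≤-trans (m≤n⇒m≤3*n m≤n) (m≤m+n (3 * n) o)

2[1+n]<3[1+n] : ∀ n → 2 * suc n < 3 * suc n
2[1+n]<3[1+n] n = *-monoˡ-< (suc n) (n<1+n 2)

2[1+n]<3[1+n]+1 : ∀ n → 2 * suc n < 3 * suc n + 1
2[1+n]<3[1+n]+1 n = ≤-trans (2[1+n]<3[1+n] n) (m≤m+n (3 * suc n) 1)

2[2+n]<3[1+n]+2 : ∀ n → 2 * suc (suc n) < 3 * suc n + 2
2[2+n]<3[1+n]+2 n =
  subst (_< 3 * suc n + 2) 2[1+n]+2≡2[2+n] (+-monoˡ-< 2 (2[1+n]<3[1+n] n))
  where
    2[1+n]+2≡2[2+n] : 2 * suc n + 2 ≡ 2 * suc (suc n)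
    2[1+n]+2≡2[2+n] = solve (n ∷ [])

half-≤ : ∀ {m n} → 2 * m ≤ 2 * n + 1 → m ≤ n
half-≤ {m} {n} 2m≤2n+1 =
  s≤s⁻¹ (*-cancelˡ-< 2 m (suc n) (≤-trans (s≤s 2m≤2n+1) (≤-reflexive (2n+1+1≡2[1+n] n))))
  where
    2n+1+1≡2[1+n] : ∀ n → suc (2 * n + 1) ≡ 2 * suc n
    2n+1+1≡2[1+n] = solve-∀

module _ (x : Word) where

  twisted-complement-⊥ : ∀ {k c} → TwistedPeriod x k c → TwistedPeriod x k (not c) → ⊥
  twisted-complement-⊥ p q with eventually-× p q
  ... | N , both with both N ≤-refl
  ... | eq , eq′ = not-¬ refl (xor-cancelˡ (x N) (trans (sym eq) eq′))

  twisted-double : ∀ {k c} → TwistedPeriod x k c → TwistedPeriod x (k + k) false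
  twisted-double {k} {c} (N , p) = N , λ n N≤n → begin
    x (n + (k + k))      ≡⟨ cong x (+-assoc n k k) ⟨
    x (n + k + k)        ≡⟨ p (n + k) (≤-trans N≤n (m≤m+n n k)) ⟩
    x (n + k) xor c      ≡⟨ cong (_xor c) (p n N≤n) ⟩
    (x n xor c) xor c    ≡⟨ xor-swap c refl ⟨
    x n                  ≡⟨ xor-identityʳ (x n) ⟨
    x n xor false        ∎

  twisted-fromHalves : ∀ {d c} →
    Eventually (λ i → x (2 * (i + d)) ≡ x (2 * i) xor c) →
    Eventually (λ i → x (2 * (i + d) + 1) ≡ x (2 * i + 1) xor c) →
    TwistedPeriod x (2 * d) c
  twisted-fromHalves {d} {c} evens odds with eventually-× evens odds
  ... | M , both = 2 * M , λ n 2M≤n → atEvenOrOdd n 2M≤n (evenOrOdd n)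
    where
      2i+1+2d≡2[i+d]+1 : ∀ i d → 2 * i + 1 + 2 * d ≡ 2 * (i + d) + 1
      2i+1+2d≡2[i+d]+1 = solve-∀

      atEvenOrOdd : ∀ n → 2 * M ≤ n → EvenOrOdd n → x (n + 2 * d) ≡ x n xor c
      atEvenOrOdd .(2 * i) 2M≤2i (even i) =
        trans (cong x (sym (*-distribˡ-+ 2 i d))) (proj₁ (both i (*-cancelˡ-≤ 2 2M≤2i)))
      atEvenOrOdd .(2 * i + 1) 2M≤2i+1 (odd i) =
        trans (cong x (2i+1+2d≡2[i+d]+1 i d)) (proj₂ (both i (half-≤ 2M≤2i+1)))

κTM-block-0 : ∀ a b → κTM-block a b 0 ≡ a
κTM-block-0 false false = refl
κTM-block-0 false true  = refl
κTM-block-0 true  false = refl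
κTM-block-0 true  true  = refl

κTM-block-1 : ∀ a b → κTM-block a b 1 ≡ b
κTM-block-1 false false = refl
κTM-block-1 false true  = refl
κTM-block-1 true  false = refl
κTM-block-1 true  true  = refl

κTM-block-2 : ∀ a b → κTM-block a b 2 ≡ not b
κTM-block-2 false false = refl
κTM-block-2 false true  = refl
κTM-block-2 true  false = refl
κTM-block-2 true  true  = refl

κTM-letter : ∀ x n r → r < 3 → κTM x (3 * n + r) ≡ κTM-block (x (2 * n)) (x (2 * n + 1)) r
κTM-letter x n r r<3 = cong₂ (λ q s → κTM-block (x (2 * q)) (x (2 * q + 1)) s) quotient remainder
  where
    3n+r≡r+n*3 : 3 * n + r ≡ r + n * 3
    3n+r≡r+n*3 = solve (n ∷ r ∷ [])

    quotient : (3 * n + r) / 3 ≡ n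
    quotient = begin
      (3 * n + r) / 3      ≡⟨ cong (_/ 3) 3n+r≡r+n*3 ⟩
      (r + n * 3) / 3      ≡⟨ +-distrib-/-∣ʳ r (divides-refl n) ⟩
      r / 3 + n * 3 / 3    ≡⟨ cong₂ _+_ (m<n⇒m/n≡0 r<3) (m*n/n≡m n 3) ⟩
      n                    ∎

    remainder : (3 * n + r) % 3 ≡ r
    remainder = begin
      (3 * n + r) % 3      ≡⟨ cong (_% 3) 3n+r≡r+n*3 ⟩
      (r + n * 3) % 3      ≡⟨ [m+kn]%n≡m%n r n 3 ⟩
      r % 3                ≡⟨ m<n⇒m%n≡m r<3 ⟩
      r                    ∎

module FixedPoint (x : Word) (fixed : ∀ m → κTM x m ≡ x m) where

  at-3n+r : ∀ n r → r < 3 → x (3 * n + r) ≡ κTM-block (x (2 * n)) (x (2 * n + 1)) r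
  at-3n+r n r r<3 = trans (sym (fixed (3 * n + r))) (κTM-letter x n r r<3)

  at-3n : ∀ n → x (3 * n) ≡ x (2 * n)
  at-3n n = begin
    x (3 * n)       ≡⟨ cong x (+-identityʳ (3 * n)) ⟨
    x (3 * n + 0)   ≡⟨ at-3n+r n 0 (s≤s z≤n) ⟩
    κTM-block (x (2 * n)) (x (2 * n + 1)) 0 ≡⟨ κTM-block-0 _ _ ⟩
    x (2 * n)       ∎

  at-3n+1 : ∀ n → x (3 * n + 1) ≡ x (2 * n + 1)
  at-3n+1 n = trans (at-3n+r n 1 (s≤s (s≤s z≤n))) (κTM-block-1 _ _)

  at-3n+2 : ∀ n → x (3 * n + 2) ≡ not (x (2 * n + 1))
  at-3n+2 n = trans (at-3n+r n 2 (s≤s (s≤s (s≤s z≤n)))) (κTM-block-2 _ _)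

  twisted-3q : ∀ {q c} → TwistedPeriod x (3 * q) c → TwistedPeriod x (2 * q) c
  twisted-3q {q} {c} (N , p) = twisted-fromHalves x (N , evens) (N , odds)
    where
      evens : ∀ i → N ≤ i → x (2 * (i + q)) ≡ x (2 * i) xor c
      evens i N≤i = begin
        x (2 * (i + q))        ≡⟨ at-3n (i + q) ⟨
        x (3 * (i + q))        ≡⟨ cong x (*-distribˡ-+ 3 i q) ⟩
        x (3 * i + 3 * q)      ≡⟨ p (3 * i) (m≤n⇒m≤3*n N≤i) ⟩
        x (3 * i) xor c        ≡⟨ cong (_xor c) (at-3n i) ⟩
        x (2 * i) xor c        ∎

      odds : ∀ i → N ≤ i → x (2 * (i + q) + 1) ≡ x (2 * i + 1) xor c
      odds i N≤i = begin
        x (2 * (i + q) + 1)    ≡⟨ at-3n+1 (i + q) ⟨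
        x (3 * (i + q) + 1)    ≡⟨ cong x (solve (i ∷ q ∷ [])) ⟩
        x (3 * i + 1 + 3 * q)  ≡⟨ p (3 * i + 1) (m≤n⇒m≤3*n+o 1 N≤i) ⟩
        x (3 * i + 1) xor c    ≡⟨ cong (_xor c) (at-3n+1 i) ⟩
        x (2 * i + 1) xor c    ∎

  twisted-3q+1 : ∀ {q c} → TwistedPeriod x (3 * q + 1) c → TwistedPeriod x (2 * q) (not c)
  twisted-3q+1 {q} {c} (N , p) = twisted-fromHalves x (N , evens) (N , odds)
    where
      odd-from-even : ∀ i → N ≤ i → x (2 * (i + q) + 1) ≡ x (2 * i) xor c
      odd-from-even i N≤i = begin
        x (2 * (i + q) + 1)      ≡⟨ at-3n+1 (i + q) ⟨
        x (3 * (i + q) + 1)      ≡⟨ cong x (solve (i ∷ q ∷ [])) ⟩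
        x (3 * i + (3 * q + 1))  ≡⟨ p (3 * i) (m≤n⇒m≤3*n N≤i) ⟩
        x (3 * i) xor c          ≡⟨ cong (_xor c) (at-3n i) ⟩
        x (2 * i) xor c          ∎

      odds : ∀ i → N ≤ i → x (2 * (i + q) + 1) ≡ x (2 * i + 1) xor not c
      odds i N≤i = begin
        x (2 * (i + q) + 1)                ≡⟨ not-involutive _ ⟨
        not (not (x (2 * (i + q) + 1)))    ≡⟨ cong not (at-3n+2 (i + q)) ⟨
        not (x (3 * (i + q) + 2))          ≡⟨ cong (λ n → not (x n)) (solve (i ∷ q ∷ [])) ⟩
        not (x (3 * i + 1 + (3 * q + 1)))  ≡⟨ cong not (p (3 * i + 1) (m≤n⇒m≤3*n+o 1 N≤i)) ⟩
        not (x (3 * i + 1) xor c)          ≡⟨ cong (λ b → not (b xor c)) (at-3n+1 i) ⟩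
        not (x (2 * i + 1) xor c)          ≡⟨ not-distribʳ-xor (x (2 * i + 1)) c ⟩
        x (2 * i + 1) xor not c            ∎

      evens : ∀ i → N ≤ i → x (2 * (i + q)) ≡ x (2 * i) xor not c
      evens i N≤i = begin
        x (2 * (i + q))                         ≡⟨ xor-swap c (odd-from-even (i + q) N≤i+q) ⟩
        x (2 * (i + q + q) + 1) xor c           ≡⟨ cong (_xor c) (odds (i + q) N≤i+q) ⟩
        (x (2 * (i + q) + 1) xor not c) xor c   ≡⟨ cong (λ b → (b xor not c) xor c) (odd-from-even i N≤i) ⟩
        ((x (2 * i) xor c) xor not c) xor c     ≡⟨ cong (_xor c) (xor-xor-not (x (2 * i)) c) ⟩
        not (x (2 * i)) xor c                   ≡⟨ not-xor (x (2 * i)) c ⟩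
        x (2 * i) xor not c                     ∎
        where
          N≤i+q : N ≤ i + q
          N≤i+q = ≤-trans N≤i (m≤m+n i q)

  twisted-3q+2 : ∀ {q c} → TwistedPeriod x (3 * q + 2) c → TwistedPeriod x (2 * suc q) (not c)
  twisted-3q+2 {q} {c} (N , p) =
    twisted-fromHalves x (eventually-shift {P = evenHalf} (suc q) (N , evens)) (N , odds)
    where
      evenHalf : ℕ → Set
      evenHalf i = x (2 * (i + suc q)) ≡ x (2 * i) xor not c

      even-from-odd : ∀ i → N ≤ i → x (2 * (i + suc q)) ≡ x (2 * i + 1) xor c
      even-from-odd i N≤i = begin
        x (2 * (i + suc q))            ≡⟨ at-3n (i + suc q) ⟨
        x (3 * (i + suc q))            ≡⟨ cong x (solve (i ∷ q ∷ [])) ⟩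
        x (3 * i + 1 + (3 * q + 2))    ≡⟨ p (3 * i + 1) (m≤n⇒m≤3*n+o 1 N≤i) ⟩
        x (3 * i + 1) xor c            ≡⟨ cong (_xor c) (at-3n+1 i) ⟩
        x (2 * i + 1) xor c            ∎

      odds : ∀ i → N ≤ i → x (2 * (i + suc q) + 1) ≡ x (2 * i + 1) xor not c
      odds i N≤i = begin
        x (2 * (i + suc q) + 1)        ≡⟨ at-3n+1 (i + suc q) ⟨
        x (3 * (i + suc q) + 1)        ≡⟨ cong x (solve (i ∷ q ∷ [])) ⟩
        x (3 * i + 2 + (3 * q + 2))    ≡⟨ p (3 * i + 2) (m≤n⇒m≤3*n+o 2 N≤i) ⟩
        x (3 * i + 2) xor c            ≡⟨ cong (_xor c) (at-3n+2 i) ⟩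
        not (x (2 * i + 1)) xor c      ≡⟨ not-xor (x (2 * i + 1)) c ⟩
        x (2 * i + 1) xor not c        ∎

      evens : ∀ i → N ≤ i → evenHalf (i + suc q)
      evens i N≤i = begin
        x (2 * (i + suc q + suc q))                    ≡⟨ even-from-odd (i + suc q) N≤i+1+q ⟩
        x (2 * (i + suc q) + 1) xor c                  ≡⟨ cong (_xor c) (odds i N≤i) ⟩
        (x (2 * i + 1) xor not c) xor c                ≡⟨ cong (λ b → (b xor not c) xor c) odd≡even ⟩
        ((x (2 * (i + suc q)) xor c) xor not c) xor c  ≡⟨ cong (_xor c) (xor-xor-not (x (2 * (i + suc q))) c) ⟩
        not (x (2 * (i + suc q))) xor c                ≡⟨ not-xor (x (2 * (i + suc q))) c ⟩
        x (2 * (i + suc q)) xor not c                  ∎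
        where
          N≤i+1+q : N ≤ i + suc q
          N≤i+1+q = ≤-trans N≤i (m≤m+n i (suc q))

          odd≡even : x (2 * i + 1) ≡ x (2 * (i + suc q)) xor c
          odd≡even = xor-swap c (even-from-odd i N≤i)

  no-twisted-period : ∀ k → 1 ≤ k → ∀ c → ¬ TwistedPeriod x k c
  no-twisted-period = <-rec _ λ k smaller → byMod3 k smaller (mod3 k)
    where
      byMod3 : ∀ k → (∀ {j} → j < k → 1 ≤ j → ∀ c → ¬ TwistedPeriod x j c) →
               Mod3 k → 1 ≤ k → ∀ c → ¬ TwistedPeriod x k c
      byMod3 _ _       (3q zero)       ()
      byMod3 _ smaller (3q (suc q))   _ c p =
        smaller (2[1+n]<3[1+n] q) (s≤s z≤n) c (twisted-3q {suc q} p)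
      byMod3 _ _       (3q+1 zero)     _ c p = twisted-complement-⊥ x p₂ (twisted-3q+2 {0} p₂)
        where
          p₂ : TwistedPeriod x 2 false
          p₂ = twisted-double x p
      byMod3 _ smaller (3q+1 (suc q)) _ c p =
        smaller (2[1+n]<3[1+n]+1 q) (s≤s z≤n) (not c) (twisted-3q+1 {suc q} p)
      byMod3 _ _       (3q+2 zero)     _ c p = twisted-complement-⊥ x p (twisted-3q+2 {0} p)
      byMod3 _ smaller (3q+2 (suc q)) _ c p =
        smaller (2[2+n]<3[1+n]+2 q) (s≤s z≤n) (not c) (twisted-3q+2 {suc q} p)

proposition3 : (x : Word) → IsFixedPoint00 x → ¬ EventuallyPeriodic x
proposition3 x (_ , _ , fixed) (N , k , 1≤k , periodic) =
  FixedPoint.no-twisted-period x fixed k 1≤k false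
    (N , λ n N≤n → trans (periodic n N≤n) (sym (xor-identityʳ (x n))))
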